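{- Let $\omega=\frac{ -1+\sqrt{ -3}}{2}$ and define the Lehmer-Euler numbers $W_n$ by $$\sum_{n=0}^\infty W_n\frac{t^n}{n!}=\frac{3}{e^{t}+e^{\omega t}+e^{\omega^2 t}}=\left(\sum_{l=0}^\infty\frac{t^{3l}}{(3l)!}\right)^{ -1}.$$ Then for every integer $n\ge 0$, $$W_{9n}\equiv(-1)^n,\quad W_{9n+3}\equiv(-1)^{n-1},\quad W_{9n+6}\equiv(-1)^{n-1}\,8\pmod{3^3}.$$ In particular, for every integer $m\ge 0$, $$W_{18m}\equiv 1,\ W_{18m+3}\equiv -1,\ W_{18m+6}\equiv -8,\ W_{18m+9}\equiv -1,\ W_{18m+12}\equiv 1,\ W_{18m+15}\equiv 8\pmod{3^3}.$$
   Context: The numbers $W_{3n}$ are integers. -}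

module Defs where

open import Data.Nat using (ℕ; zero; suc; _∸_; _/_)
import Data.Nat as ℕ
open import Data.Nat.Combinatorics using (_C_)
open import Data.Integer using (ℤ; +_; -_; _+_; _*_; _-_)
open import Data.Integer.Divisibility using (_∣_)

sum1 : ℕ → (ℕ → ℤ) → ℤ
sum1 zero    f = + 0
sum1 (suc k) f = sum1 k f + f (suc k)

-- Coefficient comparison in (Σ W_n t^n/n!) · (Σ_l t^{3l}/(3l)!) = 1 gives
--   Σ_{0 ≤ 3l ≤ n} C(n,3l) W_{n-3l} = [n = 0],
-- i.e. W_0 = 1 and W_n = - Σ_{l=1}^{⌊n/3⌋} C(n,3l) W_{n-3l} for n ≥ 1.
-- Wfuel uses a fuel argument to make the (strong) recursion structural.
Wfuel : ℕ → ℕ → ℤ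
Wfuel zero    n       = + 0
Wfuel (suc f) zero    = + 1
Wfuel (suc f) (suc n) =
  - sum1 (suc n / 3) (λ l → (+ (suc n C (3 ℕ.* l))) * Wfuel f (suc n ∸ 3 ℕ.* l))

-- Lehmer–Euler numbers W_n (fuel n+1 is sufficient since each call decreases n).
W : ℕ → ℤ
W n = Wfuel (suc n) n

_≡_[mod_] : ℤ → ℤ → ℤ → Set
a ≡ b [mod m ] = m ∣ (a - b)

-- Let ρ = residue be the sequence 1, -1, -8, -1, 1, 8, … of period 6 with ρ (k + 3) = - ρ k.
-- We show W_{3k} ≡ ρ k (mod 27) by strong induction on k; both families of congruences are
-- instances of this. Comparing coefficients gives W_{3K} = - Σ_{l=1}^{K} C(3K,3l) W_{3K-3l},
-- so it suffices that Σ_{l=0}^{K} C(3K,3l) ρ (K - l) ≡ 0 (mod 27) for K ≥ 1. By the binomial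
-- theorem this sum is the value at 0 of (1 + E)^{3K} a_K, where E shifts sequences and a_K
-- carries ρ (K - l) at position 3l and 0 elsewhere. A finite computation shows that
-- (1 + E)^9 a_k is divisible by 27 everywhere, for every k: shifting a_k by 3 gives a_{k-1},
-- and a_k depends only on k mod 6. This settles K ≥ 3; K = 1 and K = 2 are checked directly.

module Submission where

open import Defs
open import Data.Nat using (ℕ)
import Data.Nat as ℕ
open import Data.Integer using (ℤ; +_; -_; _*_; _^_; -1ℤ)
open import Data.Product using (_×_)

open import Data.Integer using (_+_; _-_)
open import Data.Integer.Divisibility.Signed
  using (_∣_; divides; _∣?_; ∣⇒∣ᵤ; ∣m∣n⇒∣m+n; ∣m∣n⇒∣m-n; ∣m⇒∣-m; ∣n⇒∣m*n)
import Data.Integer.Properties as ℤ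
open import Algebra.Properties.CommutativeSemigroup ℤ.+-commutativeSemigroup using (interchange)
import Data.Integer.Tactic.RingSolver as ℤSolver
open import Data.List using (_∷_; [])
open import Data.Nat using (zero; suc; _∸_; _≤_; _<_; s≤s; z<s; s<s)
open import Data.Nat.Combinatorics using (_C_; k>n⇒nCk≡0; nCk+nC[k+1]≡[n+1]C[k+1])
open import Data.Nat.DivMod using (_%_; m≡m%n+[m/n]*n; m%n<n; m*n/n≡m)
open import Data.Nat.Properties
  using ( ≤-refl; <-≤-trans; m≤n⇒m≤1+n; m<n⇒m<1+n; n<1+n; *-comm; *-distribˡ-+; *-distribˡ-∸
        ; *-monoʳ-<; ∸-monoʳ-<; m+[n∸m]≡n; allUpTo?)
import Data.Nat.Tactic.RingSolver as ℕSolver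
open import Data.Product using (_,_)
open import Relation.Binary.PropositionalEquality
  using (_≡_; refl; sym; trans; cong; cong₂; cong-app; subst; _≗_; module ≡-Reasoning)
open import Relation.Nullary.Decidable using (toWitness)

∑< : ℕ → (ℕ → ℤ) → ℤ
∑< zero    f = + 0
∑< (suc N) f = f 0 + ∑< N (λ i → f (suc i))

infix 5 ∑<
syntax ∑< N (λ i → e) = ∑[ i < N ] e

∑-cong : ∀ N {f g : ℕ → ℤ} → f ≗ g → ∑< N f ≡ ∑< N g
∑-cong zero    f≗g = refl
∑-cong (suc N) f≗g = cong₂ _+_ (f≗g 0) (∑-cong N (λ i → f≗g (suc i)))

∑-0 : ∀ N → ∑[ _ < N ] + 0 ≡ + 0
∑-0 zero    = refl
∑-0 (suc N) = cong (_+_ (+ 0)) (∑-0 N)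

∑-+ : ∀ N (f g : ℕ → ℤ) → ∑[ i < N ] (f i + g i) ≡ ∑< N f + ∑< N g
∑-+ zero    f g = refl
∑-+ (suc N) f g = trans (cong (_+_ (f 0 + g 0)) (∑-+ N _ _)) (interchange (f 0) (g 0) _ _)

∑-snoc : ∀ N (f : ℕ → ℤ) → ∑< (suc N) f ≡ ∑< N f + f N
∑-snoc zero    f = ℤ.+-comm (f 0) (+ 0)
∑-snoc (suc N) f = trans (cong (_+_ (f 0)) (∑-snoc N _)) (sym (ℤ.+-assoc (f 0) _ _))

sum1≡∑ : ∀ k (f : ℕ → ℤ) → sum1 k f ≡ ∑[ i < k ] f (suc i)
sum1≡∑ zero    f = refl
sum1≡∑ (suc k) f = trans (cong (_+ f (suc k)) (sum1≡∑ k f)) (sym (∑-snoc k _))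

∣f-g⇒∣sum1f-sum1g : ∀ {d} k (f g : ℕ → ℤ) → (∀ l → 1 ≤ l → l ≤ k → d ∣ f l - g l) →
                    d ∣ sum1 k f - sum1 k g
∣f-g⇒∣sum1f-sum1g     zero    f g _     = divides (+ 0) refl
∣f-g⇒∣sum1f-sum1g {d} (suc k) f g d∣f-g =
  subst (d ∣_) (sym (regroup (sum1 k f) (sum1 k g) (f (suc k)) (g (suc k))))
        (∣m∣n⇒∣m+n (∣f-g⇒∣sum1f-sum1g k f g (λ l 1≤l l≤k → d∣f-g l 1≤l (m≤n⇒m≤1+n l≤k)))
                   (d∣f-g (suc k) z<s ≤-refl))
  where
  regroup : ∀ a b x y → a + x - (b + y) ≡ (a - b) + (x - y)
  regroup = ℤSolver.solve-∀

addNext : (ℕ → ℤ) → ℕ → ℤ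
addNext q j = q j + q (suc j)

addNext^ : ℕ → (ℕ → ℤ) → ℕ → ℤ
addNext^ zero    q = q
addNext^ (suc n) q = addNext^ n (addNext q)

addNext^-cong : ∀ n {q r : ℕ → ℤ} → q ≗ r → addNext^ n q ≗ addNext^ n r
addNext^-cong zero    q≗r = q≗r
addNext^-cong (suc n) q≗r = addNext^-cong n (λ j → cong₂ _+_ (q≗r j) (q≗r (suc j)))

addNext^-+ : ∀ m n q → addNext^ (m ℕ.+ n) q ≡ addNext^ n (addNext^ m q)
addNext^-+ zero    n q = refl
addNext^-+ (suc m) n q = addNext^-+ m n (addNext q)

addNext^-suc : ∀ n q j → addNext^ n q (suc j) ≡ addNext^ n (λ i → q (suc i)) j
addNext^-suc zero    q j = refl
addNext^-suc (suc n) q j = addNext^-suc n (addNext q) j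

addNext^-shift : ∀ n q c j → addNext^ n q (c ℕ.+ j) ≡ addNext^ n (λ i → q (c ℕ.+ i)) j
addNext^-shift n q zero    j = refl
addNext^-shift n q (suc c) j = trans (addNext^-suc n q (c ℕ.+ j)) (addNext^-shift n _ c j)

∣⇒∣addNext^ : ∀ {d} n {q} → (∀ j → d ∣ q j) → ∀ j → d ∣ addNext^ n q j
∣⇒∣addNext^ zero    d∣q = d∣q
∣⇒∣addNext^ (suc n) d∣q = ∣⇒∣addNext^ n (λ j → ∣m∣n⇒∣m+n (d∣q j) (d∣q (suc j)))

∑-pascal : ∀ n {N} → n < N → (q : ℕ → ℤ) →
           ∑[ i < suc N ] + (n C i) * addNext q i ≡ ∑[ i < suc N ] + (suc n C i) * q i
∑-pascal n {N} n<N q = begin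
  ∑[ i < suc N ] c i * addNext q i
    ≡⟨ ∑-cong (suc N) (λ i → ℤ.*-distribˡ-+ (c i) (q i) (q (suc i))) ⟩
  ∑[ i < suc N ] (c i * q i + c i * q (suc i))
    ≡⟨ ∑-+ (suc N) (λ i → c i * q i) (λ i → c i * q (suc i)) ⟩
  (c 0 * q 0 + A) + (∑[ i < suc N ] c i * q (suc i))
    ≡⟨ cong (_+_ (c 0 * q 0 + A)) (trans (∑-snoc N _) (cong (_+_ B) last≡0)) ⟩
  (c 0 * q 0 + A) + (B + + 0)
    ≡⟨ regroup (c 0 * q 0) A B ⟩
  c 0 * q 0 + (B + A)
    ≡⟨ cong (_+_ (c 0 * q 0)) (sym (∑-+ N _ _)) ⟩
  c 0 * q 0 + (∑[ i < N ] (c i * q (suc i) + c (suc i) * q (suc i)))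
    ≡⟨ cong (_+_ (c 0 * q 0)) (∑-cong N pascal) ⟩
  c 0 * q 0 + (∑[ i < N ] + (suc n C suc i) * q (suc i)) ∎
  where
  open ≡-Reasoning
  c : ℕ → ℤ
  c i = + (n C i)
  A = ∑[ i < N ] c (suc i) * q (suc i)
  B = ∑[ i < N ] c i * q (suc i)
  last≡0 : c N * q (suc N) ≡ + 0
  last≡0 = trans (cong (λ m → + m * q (suc N)) (k>n⇒nCk≡0 n<N)) (ℤ.*-zeroˡ (q (suc N)))
  regroup : ∀ a x y → (a + x) + (y + + 0) ≡ a + (y + x)
  regroup = ℤSolver.solve-∀
  pascal : ∀ i → c i * q (suc i) + c (suc i) * q (suc i) ≡ + (suc n C suc i) * q (suc i)
  pascal i = trans (sym (ℤ.*-distribʳ-+ (q (suc i)) (c i) (c (suc i))))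
                   (cong (λ m → + m * q (suc i)) (nCk+nC[k+1]≡[n+1]C[k+1] n i))

addNext^-binomial : ∀ n {N} → n < N → (q : ℕ → ℤ) → addNext^ n q 0 ≡ ∑[ i < N ] + (n C i) * q i
addNext^-binomial zero    {suc N} _         q =
  sym (trans (cong (_+_ (+ 1 * q 0)) (∑-0 N)) (trans (ℤ.+-identityʳ _) (ℤ.*-identityˡ (q 0))))
addNext^-binomial (suc n) {suc N} (s<s n<N) q =
  trans (addNext^-binomial n (m<n⇒m<1+n n<N) (addNext q)) (∑-pascal n n<N q)

lacunary : (ℕ → ℤ) → ℕ → ℤ
lacunary a 0                   = a 0
lacunary a 1                   = + 0
lacunary a 2                   = + 0
lacunary a (suc (suc (suc i))) = lacunary (λ l → a (suc l)) i

lacunary-cong : ∀ {a b : ℕ → ℤ} → a ≗ b → lacunary a ≗ lacunary b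
lacunary-cong a≗b 0                   = a≗b 0
lacunary-cong a≗b 1                   = refl
lacunary-cong a≗b 2                   = refl
lacunary-cong a≗b (suc (suc (suc i))) = lacunary-cong (λ l → a≗b (suc l)) i

∑-lacunary : ∀ M (c a : ℕ → ℤ) →
             ∑[ i < M ℕ.* 3 ] c i * lacunary a i ≡ ∑[ l < M ] c (l ℕ.* 3) * a l
∑-lacunary zero    c a = refl
∑-lacunary (suc M) c a = cong (_+_ (c 0 * a 0)) (begin
  c 1 * + 0 + (c 2 * + 0 + S)
    ≡⟨ cong₂ (λ x y → x + (y + S)) (ℤ.*-zeroʳ (c 1)) (ℤ.*-zeroʳ (c 2)) ⟩
  + 0 + (+ 0 + S)
    ≡⟨ trans (ℤ.+-identityˡ _) (ℤ.+-identityˡ S) ⟩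
  S
    ≡⟨ ∑-lacunary M (λ i → c (3 ℕ.+ i)) (λ l → a (suc l)) ⟩
  ∑[ l < M ] c (suc l ℕ.* 3) * a (suc l) ∎)
  where
  open ≡-Reasoning
  S = ∑[ i < M ℕ.* 3 ] c (3 ℕ.+ i) * lacunary (λ l → a (suc l)) i

residue : ℕ → ℤ
residue 0                   = + 1
residue 1                   = - + 1
residue 2                   = - + 8
residue (suc (suc (suc k))) = - residue k

residue-periodic : ∀ t m → residue (t ℕ.* 6 ℕ.+ m) ≡ residue m
residue-periodic zero    m = refl
residue-periodic (suc t) m = trans (ℤ.neg-involutive _) (residue-periodic t m)

residue-antiperiodic : ∀ n r → residue (n ℕ.* 3 ℕ.+ r) ≡ -1ℤ ^ n * residue r
residue-antiperiodic zero    r = sym (ℤ.*-identityˡ (residue r))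
residue-antiperiodic (suc n) r = begin
  - residue (n ℕ.* 3 ℕ.+ r)    ≡⟨ cong -_ (residue-antiperiodic n r) ⟩
  - (-1ℤ ^ n * residue r)      ≡⟨ sym (ℤ.-1*i≡-i _) ⟩
  -1ℤ * (-1ℤ ^ n * residue r)  ≡⟨ sym (ℤ.*-assoc -1ℤ (-1ℤ ^ n) (residue r)) ⟩
  -1ℤ ^ suc n * residue r      ∎
  where open ≡-Reasoning

-- residue (k - l), with l * 5 + k ≡ k - l (mod 6) in place of a truncated subtraction.
residueDown : ℕ → ℕ → ℤ
residueDown k l = residue (l ℕ.* 5 ℕ.+ k)

residueDown≡residue-∸ : ∀ {k l} → l ≤ k → residueDown k l ≡ residue (k ∸ l)
residueDown≡residue-∸ {k} {l} l≤k = begin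
  residue (l ℕ.* 5 ℕ.+ k)
    ≡⟨ cong (λ m → residue (l ℕ.* 5 ℕ.+ m)) (sym (m+[n∸m]≡n l≤k)) ⟩
  residue (l ℕ.* 5 ℕ.+ (l ℕ.+ (k ∸ l)))
    ≡⟨ cong residue (regroup l (k ∸ l)) ⟩
  residue (l ℕ.* 6 ℕ.+ (k ∸ l))
    ≡⟨ residue-periodic l (k ∸ l) ⟩
  residue (k ∸ l) ∎
  where
  open ≡-Reasoning
  regroup : ∀ l d → l ℕ.* 5 ℕ.+ (l ℕ.+ d) ≡ l ℕ.* 6 ℕ.+ d
  regroup = ℕSolver.solve-∀

residueDown-suc : ∀ k l → residueDown k (suc l) ≡ residueDown (5 ℕ.+ k) l
residueDown-suc k l = cong residue (regroup l k)
  where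
  regroup : ∀ l k → 5 ℕ.+ l ℕ.* 5 ℕ.+ k ≡ l ℕ.* 5 ℕ.+ (5 ℕ.+ k)
  regroup = ℕSolver.solve-∀

residueDown-mod6 : ∀ k l → residueDown k l ≡ residueDown (k % 6) l
residueDown-mod6 k l = begin
  residue (l ℕ.* 5 ℕ.+ k)
    ≡⟨ cong (λ m → residue (l ℕ.* 5 ℕ.+ m)) (m≡m%n+[m/n]*n k 6) ⟩
  residue (l ℕ.* 5 ℕ.+ (k % 6 ℕ.+ k ℕ./ 6 ℕ.* 6))
    ≡⟨ cong residue (regroup l (k % 6) (k ℕ./ 6)) ⟩
  residue (k ℕ./ 6 ℕ.* 6 ℕ.+ (l ℕ.* 5 ℕ.+ k % 6))
    ≡⟨ residue-periodic (k ℕ./ 6) _ ⟩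
  residue (l ℕ.* 5 ℕ.+ k % 6) ∎
  where
  open ≡-Reasoning
  regroup : ∀ l r t → l ℕ.* 5 ℕ.+ (r ℕ.+ t ℕ.* 6) ≡ t ℕ.* 6 ℕ.+ (l ℕ.* 5 ℕ.+ r)
  regroup = ℕSolver.solve-∀

27∣addNext^9-lacunary-residueDown-<3 : ∀ k {j} → j < 3 →
                                         + 27 ∣ addNext^ 9 (lacunary (residueDown k)) j
27∣addNext^9-lacunary-residueDown-<3 k {j} j<3 =
  subst (+ 27 ∣_) (addNext^-cong 9 (lacunary-cong (λ l → sym (residueDown-mod6 k l))) j)
        (window (m%n<n k 6) j<3)
  where
  window : ∀ {k} → k < 6 → ∀ {j} → j < 3 → + 27 ∣ addNext^ 9 (lacunary (residueDown k)) j
  window = toWitness {a? = allUpTo? (λ k → allUpTo? (λ j →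
             + 27 ∣? addNext^ 9 (lacunary (residueDown k)) j) 3) 6} _

27∣addNext^9-lacunary-residueDown : ∀ k j → + 27 ∣ addNext^ 9 (lacunary (residueDown k)) j
27∣addNext^9-lacunary-residueDown k 0 = 27∣addNext^9-lacunary-residueDown-<3 k z<s
27∣addNext^9-lacunary-residueDown k 1 = 27∣addNext^9-lacunary-residueDown-<3 k (s<s z<s)
27∣addNext^9-lacunary-residueDown k 2 = 27∣addNext^9-lacunary-residueDown-<3 k (s<s (s<s z<s))
27∣addNext^9-lacunary-residueDown k (suc (suc (suc j))) =
  subst (+ 27 ∣_) (sym shift) (27∣addNext^9-lacunary-residueDown (5 ℕ.+ k) j)
  where
  shift : addNext^ 9 (lacunary (residueDown k)) (3 ℕ.+ j) ≡
          addNext^ 9 (lacunary (residueDown (5 ℕ.+ k))) j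
  shift = trans (addNext^-shift 9 (lacunary (residueDown k)) 3 j)
                (addNext^-cong 9 (lacunary-cong (residueDown-suc k)) j)

27∣addNext^[3K]-lacunary-residueDown : ∀ k →
  + 27 ∣ addNext^ (3 ℕ.* suc k) (lacunary (residueDown (suc k))) 0
27∣addNext^[3K]-lacunary-residueDown 0 = divides (+ 0) refl
27∣addNext^[3K]-lacunary-residueDown 1 = divides -1ℤ refl
27∣addNext^[3K]-lacunary-residueDown (suc (suc k)) =
  subst (+ 27 ∣_) (sym (cong-app split 0))
        (∣⇒∣addNext^ (3 ℕ.* k) (27∣addNext^9-lacunary-residueDown (3 ℕ.+ k)) 0)
  where
  q = lacunary (residueDown (3 ℕ.+ k))
  split : addNext^ (3 ℕ.* (3 ℕ.+ k)) q ≡ addNext^ (3 ℕ.* k) (addNext^ 9 q)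
  split = trans (cong (λ n → addNext^ n q) (*-distribˡ-+ 3 3 k)) (addNext^-+ 9 (3 ℕ.* k) q)

residue+sum1≡addNext^ : ∀ K →
  residue K + sum1 K (λ l → + (3 ℕ.* K C 3 ℕ.* l) * residueDown K l) ≡
  addNext^ (3 ℕ.* K) (lacunary (residueDown K)) 0
residue+sum1≡addNext^ K = sym (begin
  addNext^ (3 ℕ.* K) (lacunary (residueDown K)) 0
    ≡⟨ addNext^-binomial (3 ℕ.* K) 3K<[1+K]*3 _ ⟩
  ∑[ i < suc K ℕ.* 3 ] c i * lacunary (residueDown K) i
    ≡⟨ ∑-lacunary (suc K) c (residueDown K) ⟩
  ∑[ l < suc K ] c (l ℕ.* 3) * residueDown K l
    ≡⟨ cong₂ _+_ (ℤ.*-identityˡ (residue K))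
                 (∑-cong K (λ l → cong (λ m → c m * residueDown K (suc l)) (*-comm (suc l) 3))) ⟩
  residue K + (∑[ l < K ] c (3 ℕ.* suc l) * residueDown K (suc l))
    ≡⟨ cong (_+_ (residue K)) (sym (sum1≡∑ K _)) ⟩
  residue K + sum1 K (λ l → c (3 ℕ.* l) * residueDown K l) ∎)
  where
  open ≡-Reasoning
  c : ℕ → ℤ
  c i = + (3 ℕ.* K C i)
  3K<[1+K]*3 : 3 ℕ.* K < suc K ℕ.* 3
  3K<[1+K]*3 = subst (3 ℕ.* K <_) (*-comm 3 (suc K)) (*-monoʳ-< 3 (n<1+n K))

27∣residue+sum1 : ∀ k → let K = suc k in
  + 27 ∣ residue K + sum1 K (λ l → + (3 ℕ.* K C 3 ℕ.* l) * residueDown K l)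
27∣residue+sum1 k =
  subst (+ 27 ∣_) (sym (residue+sum1≡addNext^ (suc k))) (27∣addNext^[3K]-lacunary-residueDown k)

Wfuel-3K-recurrence : ∀ f k → let K = suc k in
  Wfuel (suc f) (3 ℕ.* K) ≡ - sum1 K (λ l → + (3 ℕ.* K C 3 ℕ.* l) * Wfuel f (3 ℕ.* K ∸ 3 ℕ.* l))
Wfuel-3K-recurrence f k = cong (λ m → - sum1 m term) 3K/3≡K
  where
  K = suc k
  term : ℕ → ℤ
  term l = + (3 ℕ.* K C 3 ℕ.* l) * Wfuel f (3 ℕ.* K ∸ 3 ℕ.* l)
  3K/3≡K : 3 ℕ.* K ℕ./ 3 ≡ K
  3K/3≡K = trans (cong (ℕ._/ 3) (*-comm 3 K)) (m*n/n≡m K 3)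

27∣Wfuel-3k-residue : ∀ f k → 3 ℕ.* k < f → + 27 ∣ Wfuel f (3 ℕ.* k) - residue k
27∣Wfuel-3k-residue (suc f) zero    _          = divides (+ 0) refl
27∣Wfuel-3k-residue (suc f) (suc k) (s≤s 3K≤f) =
  subst (+ 27 ∣_) rearrange
        (∣m∣n⇒∣m-n (∣m⇒∣-m (∣f-g⇒∣sum1f-sum1g K F G termwise)) (27∣residue+sum1 k))
  where
  K = suc k
  c : ℕ → ℤ
  c l = + (3 ℕ.* K C 3 ℕ.* l)
  F G : ℕ → ℤ
  F l = c l * Wfuel f (3 ℕ.* K ∸ 3 ℕ.* l)
  G l = c l * residueDown K l
  termwise : ∀ l → 1 ≤ l → l ≤ K → + 27 ∣ F l - G l
  termwise l 1≤l l≤K = subst (+ 27 ∣_) eq (∣n⇒∣m*n (c l) IH)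
    where
    IH : + 27 ∣ Wfuel f (3 ℕ.* (K ∸ l)) - residue (K ∸ l)
    IH = 27∣Wfuel-3k-residue f (K ∸ l) (<-≤-trans (*-monoʳ-< 3 (∸-monoʳ-< 1≤l l≤K)) 3K≤f)
    distrib : ∀ a x y → a * (x - y) ≡ a * x - a * y
    distrib = ℤSolver.solve-∀
    eq : c l * (Wfuel f (3 ℕ.* (K ∸ l)) - residue (K ∸ l)) ≡ F l - G l
    eq = trans (distrib (c l) _ _)
               (cong₂ (λ m x → c l * Wfuel f m - c l * x)
                      (*-distribˡ-∸ 3 K l) (sym (residueDown≡residue-∸ l≤K)))
  regroup : ∀ a b r → - (a - b) - (r + b) ≡ - a - r
  regroup = ℤSolver.solve-∀
  rearrange : - (sum1 K F - sum1 K G) - (residue K + sum1 K G) ≡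
              Wfuel (suc f) (3 ℕ.* K) - residue K
  rearrange = trans (regroup (sum1 K F) (sum1 K G) (residue K))
                    (cong (_- residue K) (sym (Wfuel-3K-recurrence f k)))

W-3k≡residue : ∀ k → W (3 ℕ.* k) ≡ residue k [mod + 27 ]
W-3k≡residue k = ∣⇒∣ᵤ (27∣Wfuel-3k-residue (suc (3 ℕ.* k)) k ≤-refl)

W-congruence : ∀ n k {v} → n ≡ 3 ℕ.* k → residue k ≡ v → W n ≡ v [mod + 27 ]
W-congruence _ k refl refl = W-3k≡residue k

theorem4 :
    ((n : ℕ) →
      (W (9 ℕ.* n) ≡ -1ℤ ^ n [mod + 27 ])
      × (W (9 ℕ.* n ℕ.+ 3) ≡ - (-1ℤ ^ n) [mod + 27 ])
      × (W (9 ℕ.* n ℕ.+ 6) ≡ - (-1ℤ ^ n) * + 8 [mod + 27 ]))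
    × ((m : ℕ) →
      (W (18 ℕ.* m) ≡ + 1 [mod + 27 ])
      × (W (18 ℕ.* m ℕ.+ 3) ≡ - + 1 [mod + 27 ])
      × (W (18 ℕ.* m ℕ.+ 6) ≡ - + 8 [mod + 27 ])
      × (W (18 ℕ.* m ℕ.+ 9) ≡ - + 1 [mod + 27 ])
      × (W (18 ℕ.* m ℕ.+ 12) ≡ + 1 [mod + 27 ])
      × (W (18 ℕ.* m ℕ.+ 15) ≡ + 8 [mod + 27 ]))
theorem4 =
  (λ n →
    W-congruence (9 ℕ.* n) (n ℕ.* 3 ℕ.+ 0) (ℕSolver.solve (n ∷ []))
      (trans (residue-antiperiodic n 0) (ℤ.*-identityʳ (-1ℤ ^ n))) ,
    W-congruence (9 ℕ.* n ℕ.+ 3) (n ℕ.* 3 ℕ.+ 1) (ℕSolver.solve (n ∷ []))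
      (trans (residue-antiperiodic n 1) (times-1 (-1ℤ ^ n))) ,
    W-congruence (9 ℕ.* n ℕ.+ 6) (n ℕ.* 3 ℕ.+ 2) (ℕSolver.solve (n ∷ []))
      (trans (residue-antiperiodic n 2) (times-8 (-1ℤ ^ n)))) ,
  (λ m →
    W-congruence (18 ℕ.* m)       (m ℕ.* 6 ℕ.+ 0) (ℕSolver.solve (m ∷ [])) (residue-periodic m 0) ,
    W-congruence (18 ℕ.* m ℕ.+ 3)  (m ℕ.* 6 ℕ.+ 1) (ℕSolver.solve (m ∷ [])) (residue-periodic m 1) ,
    W-congruence (18 ℕ.* m ℕ.+ 6)  (m ℕ.* 6 ℕ.+ 2) (ℕSolver.solve (m ∷ [])) (residue-periodic m 2) ,
    W-congruence (18 ℕ.* m ℕ.+ 9)  (m ℕ.* 6 ℕ.+ 3) (ℕSolver.solve (m ∷ [])) (residue-periodic m 3) ,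
    W-congruence (18 ℕ.* m ℕ.+ 12) (m ℕ.* 6 ℕ.+ 4) (ℕSolver.solve (m ∷ [])) (residue-periodic m 4) ,
    W-congruence (18 ℕ.* m ℕ.+ 15) (m ℕ.* 6 ℕ.+ 5) (ℕSolver.solve (m ∷ [])) (residue-periodic m 5))
  where
  times-1 : ∀ x → x * - + 1 ≡ - x
  times-1 = ℤSolver.solve-∀
  times-8 : ∀ x → x * - + 8 ≡ - x * + 8
  times-8 = ℤSolver.solve-∀
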